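{- If $(G,\sim,\mathcal{R})$ is a gentle framed turbulence chart, then every connected component of $G$ contains at least one fringe edge.
   Context: Graphs are finite undirected graphs, loops and multiple edges allowed, every vertex incident to some edge; degree-one vertices are fringe, others internal; fringe edges are those incident to a fringe vertex; a half-edge is a pair (edge, endpoint), each edge having two. A framed turbulence chart $(G,\sim,\mathcal R)$ has, at each internal $v$, an equivalence relation $\sim_v$ on the half-edges at $v$ with exactly two nonempty classes, and a linear order on each class. An oriented edge $\tilde e=e^te^h$ orders the half-edges of an edge. A string is a sequence of oriented edges $\tilde e_1\cdots\tilde e_m$ with $h(\tilde e_j)=t(\tilde e_{j+1})$ and $e_j^h,e_{j+1}^t$ in different classes of $\sim_{h(\tilde e_j)}$; a band is a string $B$ with $BB$ a string that is not a power of a shorter string. A half-edge is lonely if it is at a fringe vertex or alone in its class; in a full chart, a non-lonely half-edge is high if it is the larger of its class, low otherwise. An oriented edge $e^te^h$ is ascending if $e^t$ is low or lonely and $e^h$ is high or lonely; descending if $e^t$ is high or lonely and $e^h$ low or lonely; an edge is steep if some orientation is ascending or descending. The chart is gentle if (1) every class of every $\sim_v$ has exactly two elements, (2) every edge is incident to an internal vertex, (3) every edge is steep, (4) no band consists entirely of ascending or entirely of descending oriented edges. -}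

module Defs where

open import Data.Nat using (ℕ; zero; suc; _<_)
open import Data.Fin using (Fin; zero; suc)
open import Data.Bool using (Bool)
open import Data.Product using (Σ; ∃; _×_; _,_)
open import Data.Sum using (_⊎_)
open import Data.Unit using (⊤)
open import Data.List using (List; []; _∷_; _++_; length)
open import Data.List.Relation.Unary.All using (All)
open import Relation.Nullary using (¬_)
open import Relation.Binary.PropositionalEquality using (_≡_; _≢_)

-- the other end of an edge: Fin 2 indexes the two half-edges of an edge
flip : Fin 2 → Fin 2
flip zero = suc zero
flip (suc zero) = zero

-- Graphs: finite, undirected, loops and multiple edges allowed.
-- Vertices Fin nV, edges Fin nE; half-edge (e , i) with i : Fin 2 has
-- endpoint ends e i.  Every vertex is incident to some edge.

HalfEdgeOf : ℕ → Set
HalfEdgeOf nE = Fin nE × Fin 2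

record Graph : Set where
  field
    nV nE : ℕ
    ends  : Fin nE → Fin 2 → Fin nV
  HalfEdge : Set
  HalfEdge = HalfEdgeOf nE
  vert : HalfEdge → Fin nV
  vert (e , i) = ends e i
  field
    covered : ∀ (v : Fin nV) → Σ HalfEdge (λ h → vert h ≡ v)

module GraphNotions (G : Graph) where
  open Graph G public

  Fringe : Fin nV → Set
  Fringe v = Σ HalfEdge λ h → vert h ≡ v × (∀ h' → vert h' ≡ v → h' ≡ h)

  Internal : Fin nV → Set
  Internal v = Σ HalfEdge λ h → Σ HalfEdge λ h' → h ≢ h' × vert h ≡ v × vert h' ≡ v

  FringeEdge : Fin nE → Set
  FringeEdge e = Σ (Fin 2) λ i → Fringe (ends e i)

  data Connected (u : Fin nV) : Fin nV → Set where
    here : Connected u u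
    step : ∀ {v} → Connected u v → (e : Fin nE) (i : Fin 2) → ends e i ≡ v →
           Connected u (ends e (flip i))

-- The equivalence relation ∼_v at an internal vertex v is given as the
-- kernel of a labelling cls of the half-edges at v by Bool, both labels
-- occurring (so exactly two nonempty classes).  The linear orders on the
-- classes are given by a strict relation ≺ relating only half-edges in the
-- same class, which is a strict total order on every class.

record Chart (G : Graph) : Set₁ where
  open GraphNotions G
  field
    cls : HalfEdge → Bool
  SameClass : HalfEdge → HalfEdge → Set
  SameClass h h' = vert h ≡ vert h' × Internal (vert h) × cls h ≡ cls h'
  field
    twoClasses : ∀ v → Internal v → ∀ (b : Bool) → Σ HalfEdge λ h → vert h ≡ v × cls h ≡ b
    _≺_       : HalfEdge → HalfEdge → Set
    ≺-within  : ∀ {h h'} → h ≺ h' → SameClass h h'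
    ≺-irrefl  : ∀ {h} → ¬ (h ≺ h)
    ≺-trans   : ∀ {h h' h''} → h ≺ h' → h' ≺ h'' → h ≺ h''
    ≺-total   : ∀ {h h'} → SameClass h h' → h ≢ h' → (h ≺ h') ⊎ (h' ≺ h)

module ChartNotions (G : Graph) (C : Chart G) where
  open GraphNotions G public
  open Chart C public

  Lonely : HalfEdge → Set
  Lonely h = Fringe (vert h) ⊎ (∀ h' → SameClass h h' → h' ≡ h)

  High : HalfEdge → Set
  High h = ¬ Lonely h × (∀ h' → SameClass h h' → h' ≢ h → h' ≺ h)

  Low : HalfEdge → Set
  Low h = ¬ Lonely h × ¬ High h

  OEdge : Set
  OEdge = Fin nE × Fin 2

  tailH : OEdge → HalfEdge
  tailH (e , d) = (e , d)

  headH : OEdge → HalfEdge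
  headH (e , d) = (e , flip d)

  Ascending : OEdge → Set
  Ascending o = (Low (tailH o) ⊎ Lonely (tailH o)) × (High (headH o) ⊎ Lonely (headH o))

  Descending : OEdge → Set
  Descending o = (High (tailH o) ⊎ Lonely (tailH o)) × (Low (headH o) ⊎ Lonely (headH o))

  Steep : Fin nE → Set
  Steep e = Σ (Fin 2) λ d → Ascending (e , d) ⊎ Descending (e , d)

  Composable : OEdge → OEdge → Set
  Composable o o' = vert (headH o) ≡ vert (tailH o') × Internal (vert (headH o))
                    × cls (headH o) ≢ cls (tailH o')

  Consecutive : List OEdge → Set
  Consecutive [] = ⊤
  Consecutive (x ∷ []) = ⊤
  Consecutive (x ∷ y ∷ r) = Composable x y × Consecutive (y ∷ r)

  IsString : List OEdge → Set
  IsString l = l ≢ [] × Consecutive l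

  power : List OEdge → ℕ → List OEdge
  power c zero = []
  power c (suc k) = c ++ power c k

  IsBand : List OEdge → Set
  IsBand B = IsString (B ++ B) ×
             ¬ (Σ (List OEdge) λ c → IsString c × length c < length B × Σ ℕ λ k → B ≡ power c k)

  Gentle : Set
  Gentle =
    (∀ h → Internal (vert h) →
       Σ HalfEdge λ h' → h' ≢ h × SameClass h h' ×
         (∀ h'' → SameClass h h'' → (h'' ≡ h) ⊎ (h'' ≡ h'))) ×
    (∀ e → Σ (Fin 2) λ i → Internal (ends e i)) ×
    (∀ e → Steep e) ×
    (∀ B → IsBand B → ¬ (All Ascending B ⊎ All Descending B))

-- Walk from v: leave each vertex by a low half-edge. Steepness forces an edge with
-- low tail to be ascending, and since classes are pairs, an internal head vertex
-- always offers a low half-edge in the other class to continue. So the walk either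
-- reaches a fringe vertex or, after more steps than there are oriented edges,
-- repeats an oriented edge. The stretch B between two repeats is ascending with BB
-- a string, and the primitive root of B is an ascending band, which gentleness forbids.
module Submission where

open import Defs
open import Data.Bool using (Bool; true; not)
open import Data.Bool.Properties using (not-¬)
open import Data.Empty using (⊥-elim)
open import Data.Fin using (Fin; zero; suc; combine) renaming (_<_ to _<ᶠ_)
import Data.Fin.Properties as Fin
open import Data.List using (List; []; _∷_; _++_; [_]; length; lookup)
open import Data.List.Properties using (++-assoc; ++-identityʳ; ++-conicalˡ)
open import Data.List.Membership.Propositional using (_∈_)
open import Data.List.Membership.Propositional.Properties using (∈-lookup; ∈-∃++)
open import Data.List.Relation.Unary.All using (All; []; _∷_)
import Data.List.Relation.Unary.All.Properties as All
open import Data.Nat using (ℕ; zero; suc; _*_; _<_; s≤s)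
open import Data.Nat.Properties using (<-irrefl; ≤-refl)
open import Data.Nat.Induction using (<-wellFounded)
open import Data.Product using (Σ; ∃₂; _×_; _,_; proj₁; proj₂; uncurry)
import Data.Product.Properties as Product
open import Data.Sum using (_⊎_; inj₁; inj₂)
open import Data.Unit using (tt)
open import Function.Definitions using (Injective)
open import Induction.WellFounded using (Acc; acc)
open import Relation.Nullary using (¬_; yes; no)
open import Relation.Nullary.Decidable using (_×-dec_; ¬?)
open import Relation.Binary.Definitions using (DecidableEquality)
open import Relation.Binary.PropositionalEquality using (_≡_; _≢_; refl; sym; trans; cong; subst)

module _ {a} {A : Set a} where

  Repeats : List A → Set a
  Repeats xs = ∃₂ λ p m → ∃₂ λ x s → xs ≡ p ++ x ∷ m ++ x ∷ s

  lookup-repeat⇒Repeats : ∀ (xs : List A) {i j} → i <ᶠ j →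
                          lookup xs i ≡ lookup xs j → Repeats xs
  lookup-repeat⇒Repeats (x ∷ xs) {zero} {suc j} _ eq
    with m , s , refl ← ∈-∃++ (subst (_∈ xs) (sym eq) (∈-lookup j)) = [] , m , x , s , refl
  lookup-repeat⇒Repeats (x ∷ xs) {suc i} {suc j} (s≤s i<j) eq
    with p , m , y , s , refl ← lookup-repeat⇒Repeats xs i<j eq = x ∷ p , m , y , s , refl

  Repeats-pigeonhole : ∀ {n} (f : A → Fin n) → Injective _≡_ _≡_ f →
                       ∀ xs → n < length xs → Repeats xs
  Repeats-pigeonhole f f-inj xs n<len
    with i , j , i<j , eq ← Fin.pigeonhole n<len (λ k → f (lookup xs k)) =
    lookup-repeat⇒Repeats xs i<j (f-inj eq)

module _ (G : Graph) (C : Chart G) where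
  open ChartNotions G C

  consecutive-++⁻ˡ : ∀ xs {ys} → Consecutive (xs ++ ys) → Consecutive xs
  consecutive-++⁻ˡ []          _        = tt
  consecutive-++⁻ˡ (x ∷ [])    _        = tt
  consecutive-++⁻ˡ (x ∷ y ∷ r) (c , cs) = c , consecutive-++⁻ˡ (y ∷ r) cs

  consecutive-++⁻ʳ : ∀ xs {ys} → Consecutive (xs ++ ys) → Consecutive ys
  consecutive-++⁻ʳ []                   cs       = cs
  consecutive-++⁻ʳ (x ∷ []) {[]}        _        = tt
  consecutive-++⁻ʳ (x ∷ []) {y ∷ ys}    (_ , cs) = cs
  consecutive-++⁻ʳ (x ∷ y ∷ r)          (_ , cs) = consecutive-++⁻ʳ (y ∷ r) cs

  consecutive-splice : ∀ xs {y ys} → Consecutive (xs ++ [ y ]) → Consecutive (y ∷ ys) →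
                       Consecutive (xs ++ y ∷ ys)
  consecutive-splice []          _        cs = cs
  consecutive-splice (x ∷ [])    (c , _)  cs = c , cs
  consecutive-splice (x ∷ z ∷ r) (c , c′) cs = c , consecutive-splice (z ∷ r) c′ cs

  consecutive-repeat⇒square : ∀ {p m x s} → Consecutive (p ++ x ∷ m ++ x ∷ s) →
                              IsString ((x ∷ m) ++ (x ∷ m))
  consecutive-repeat⇒square {p} {m} {x} {s} cs = (λ ()) , consecutive-splice (x ∷ m) closed open′
    where
    closed : Consecutive ((x ∷ m) ++ [ x ])
    closed = consecutive-++⁻ˡ ((x ∷ m) ++ [ x ])
               (subst Consecutive (sym (++-assoc (x ∷ m) [ x ] s)) (consecutive-++⁻ʳ p cs))
    open′ : Consecutive (x ∷ m)
    open′ = consecutive-++⁻ˡ (x ∷ m) closed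

  -- A square BB that is not a band has B = cc⋯c with c shorter, and cc is again a square.
  noBand⇒noSquare : ∀ {ℓ} {P : OEdge → Set ℓ} → (∀ B → IsBand B → ¬ All P B) →
                    ∀ B → IsString (B ++ B) → ¬ All P B
  noBand⇒noSquare {P = P} noBand B = go B (<-wellFounded (length B))
    where
    go : ∀ B → Acc _<_ (length B) → IsString (B ++ B) → ¬ All P B
    go B (acc rec) BB all = noBand B (BB , notPower) all
      where
      notPower : ¬ Σ (List OEdge) λ c → IsString c × length c < length B ×
                                           Σ ℕ λ k → B ≡ power c k
      notPower (c , _     , c<B , zero , refl)    = proj₁ BB refl
      notPower (c , _     , c<B , suc zero , refl) =
        <-irrefl (cong length (sym (++-identityʳ c))) c<B
      notPower (c , c-str , c<B , suc (suc k) , refl) =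
        go c (rec c<B) cc (All.++⁻ˡ c all)
        where
        cc : IsString (c ++ c)
        cc = (λ eq → proj₁ c-str (++-conicalˡ c c eq))
           , consecutive-++⁻ˡ (c ++ c)
               (subst Consecutive (sym (++-assoc c c (power c k)))
                 (consecutive-++⁻ˡ (c ++ c ++ power c k) (proj₂ BB)))

  _≟ᴴ_ : DecidableEquality HalfEdge
  _≟ᴴ_ = Product.≡-dec Fin._≟_ Fin._≟_

  Fringe⇒¬Internal : ∀ {w} → Fringe w → ¬ Internal w
  Fringe⇒¬Internal (h , _ , unique) (a , b , a≢b , a-at , b-at) =
    a≢b (trans (unique a a-at) (sym (unique b b-at)))

  Fringe⊎Internal : ∀ w → Fringe w ⊎ Internal w
  Fringe⊎Internal w with h , h-at ← Graph.covered G w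
    with Fin.any? (λ e → Fin.any? (λ i → (ends e i Fin.≟ w) ×-dec ¬? ((e , i) ≟ᴴ h)))
  ... | yes (e , i , at , ≢h) = inj₂ ((e , i) , h , ≢h , at , h-at)
  ... | no ¬other = inj₁ (h , h-at , unique)
    where
    unique : ∀ h′ → vert h′ ≡ w → h′ ≡ h
    unique h′ h′-at with h′ ≟ᴴ h
    ... | yes eq = eq
    ... | no h′≢h = ⊥-elim (¬other (proj₁ h′ , proj₂ h′ , h′-at , h′≢h))

  ≺⇒Low : ∀ {x y} → x ≺ y → Low x
  ≺⇒Low {x} {y} x≺y = notLonely , notHigh
    where
    sc : SameClass x y
    sc = ≺-within x≺y
    y≢x : y ≢ x
    y≢x refl = ≺-irrefl x≺y
    notLonely : ¬ Lonely x
    notLonely (inj₁ fringe) = Fringe⇒¬Internal fringe (proj₁ (proj₂ sc))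
    notLonely (inj₂ alone)  = y≢x (alone y sc)
    notHigh : ¬ High x
    notHigh (_ , top) = ≺-irrefl (≺-trans x≺y (top y sc y≢x))

  Low⇒¬High⊎Lonely : ∀ {x} → Low x → ¬ (High x ⊎ Lonely x)
  Low⇒¬High⊎Lonely (_ , ¬high) (inj₁ high)   = ¬high high
  Low⇒¬High⊎Lonely (¬lonely , _) (inj₂ lonely) = ¬lonely lonely

  Low-tail⇒Ascending : ∀ {e d} → Low (e , d) → Steep e → Ascending (e , d)
  Low-tail⇒Ascending {e} {d} low (d′ , steep) = inj₁ low , head d d′ low steep
    where
    head : ∀ d d′ → Low (e , d) → Ascending (e , d′) ⊎ Descending (e , d′) →
           High (e , flip d) ⊎ Lonely (e , flip d)
    head zero       zero       _   (inj₁ (_ , hd)) = hd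
    head zero       zero       low (inj₂ (tl , _)) = ⊥-elim (Low⇒¬High⊎Lonely low tl)
    head zero       (suc zero) low (inj₁ (_ , hd)) = ⊥-elim (Low⇒¬High⊎Lonely low hd)
    head zero       (suc zero) _   (inj₂ (tl , _)) = tl
    head (suc zero) (suc zero) _   (inj₁ (_ , hd)) = hd
    head (suc zero) (suc zero) low (inj₂ (tl , _)) = ⊥-elim (Low⇒¬High⊎Lonely low tl)
    head (suc zero) zero       low (inj₁ (_ , hd)) = ⊥-elim (Low⇒¬High⊎Lonely low hd)
    head (suc zero) zero       _   (inj₂ (tl , _)) = tl

  module _ (gentle : Gentle) where

    class-partner : ∀ h → Internal (vert h) → Σ HalfEdge λ h′ → h′ ≢ h × SameClass h h′
    class-partner h int with h′ , h′≢h , sc , _ ← proj₁ gentle h int = h′ , h′≢h , sc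

    Low-in-class : ∀ {w} → Internal w → (b : Bool) →
                   Σ HalfEdge λ h → vert h ≡ w × cls h ≡ b × Low h
    Low-in-class {w} int b with a , a-at , a-cls ← twoClasses w int b
      with a′ , a′≢a , at , _ , same ← class-partner a (subst Internal (sym a-at) int)
      with ≺-total (at , subst Internal (sym a-at) int , same) (λ eq → a′≢a (sym eq))
    ... | inj₁ a≺a′ = a , a-at , a-cls , ≺⇒Low a≺a′
    ... | inj₂ a′≺a = a′ , trans (sym at) a-at , trans (sym same) a-cls , ≺⇒Low a′≺a

    no-repeating-ascending-string : ∀ w → Consecutive w → All Ascending w → ¬ Repeats w
    no-repeating-ascending-string w cs asc (p , m , x , s , refl) =
      noBand⇒noSquare noAscendingBand (x ∷ m) (consecutive-repeat⇒square {p} cs)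
        (All.++⁻ˡ (x ∷ m) (All.++⁻ʳ p asc))
      where
      noAscendingBand : ∀ B → IsBand B → ¬ All Ascending B
      noAscendingBand B band asc = proj₂ (proj₂ (proj₂ gentle)) B band (inj₁ asc)

    module _ (v : Fin nV) where

      ReachesFringe : Set
      ReachesFringe = Σ (Fin nE) λ e → FringeEdge e × Σ (Fin 2) λ i → Connected v (ends e i)

      Ascent : Set
      Ascent = Σ OEdge λ o → Low (tailH o) × Connected v (vert (tailH o))

      Ascent⇒Ascending : (a : Ascent) → Ascending (proj₁ a)
      Ascent⇒Ascending ((e , _) , low , _) =
        Low-tail⇒Ascending low (proj₁ (proj₂ (proj₂ gentle)) e)

      ascent-start : ReachesFringe ⊎ Ascent
      ascent-start with Fringe⊎Internal v
      ... | inj₁ fringe@((e , i) , refl , _) = inj₁ (e , (i , fringe) , i , here)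
      ... | inj₂ int with h , refl , _ , low ← Low-in-class int true = inj₂ (h , low , here)

      ascend : (a : Ascent) → ReachesFringe ⊎ Σ Ascent λ a′ → Composable (proj₁ a) (proj₁ a′)
      ascend ((e , d) , _ , conn) with Fringe⊎Internal (ends e (flip d))
      ... | inj₁ fringe = inj₁ (e , (flip d , fringe) , flip d , step conn e d refl)
      ... | inj₂ int with h , at , h-cls , low ← Low-in-class int (not (cls (e , flip d))) =
        inj₂ ((h , low , subst (Connected v) (sym at) (step conn e d refl)) ,
              sym at , int , λ eq → not-¬ refl (trans eq h-cls))

      climb : ∀ n (a : Ascent) → ReachesFringe ⊎
              Σ (List OEdge) λ t → length t ≡ n ×
                Consecutive (proj₁ a ∷ t) × All Ascending (proj₁ a ∷ t)
      climb zero    a = inj₂ ([] , refl , tt , Ascent⇒Ascending a ∷ [])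
      climb (suc n) a with ascend a
      ... | inj₁ r = inj₁ r
      ... | inj₂ (a′ , composable) with climb n a′
      ... | inj₁ r = inj₁ r
      ... | inj₂ (t , len , cs , asc) =
        inj₂ (proj₁ a′ ∷ t , cong suc len , (composable , cs) , Ascent⇒Ascending a ∷ asc)

lemma6p5 : (G : Graph) (C : Chart G) → ChartNotions.Gentle G C →
    ∀ (v : Fin (Graph.nV G)) →
      Σ (Fin (Graph.nE G)) λ e → GraphNotions.FringeEdge G e ×
        Σ (Fin 2) λ i → GraphNotions.Connected G v (Graph.ends G e i)
lemma6p5 G C gentle v with ascent-start G C gentle v
... | inj₁ r = r
... | inj₂ a with climb G C gentle v (Graph.nE G * 2) a
... | inj₁ r = r
... | inj₂ (t , len , cs , asc) =
  ⊥-elim (no-repeating-ascending-string G C gentle (proj₁ a ∷ t) cs asc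
    (Repeats-pigeonhole (uncurry combine) combine-injective (proj₁ a ∷ t)
      (subst (Graph.nE G * 2 <_) (cong suc (sym len)) ≤-refl)))
  where
  combine-injective : Injective _≡_ _≡_ (uncurry combine)
  combine-injective {e , d} {e′ , d′} eq
    with refl , refl ← Fin.combine-injective e d e′ d′ eq = refl
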